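{- For real or complex $\alpha,\beta,\gamma,x,\lambda$ and every integer $n\ge0$, $$xA^{\lambda+1,x}_{n}(\alpha,\beta,\gamma+\beta)=(x+1)A^{\lambda+1,x}_{n}(\alpha,\beta,\gamma)-A^{\lambda,x}_{n}(\alpha,\beta,\gamma)$$ and $$A^{\lambda,x}_{n+1}(\alpha,\beta,\gamma-\alpha)-(x+1)\lambda\beta\,A^{\lambda+1,x}_{n}(\alpha,\beta,\gamma)=(\gamma-\alpha-\lambda\beta)\,A^{\lambda,x}_{n}(\alpha,\beta,\gamma).$$
   Context: For a number $\alpha$ and integer $n\ge0$, $(t|\alpha)_n=t(t-\alpha)\cdots(t-(n-1)\alpha)$, $(t|\alpha)_0=1$. For numbers $\alpha,\beta,\gamma$ the generalised Stirling numbers $S(n,k,\alpha,\beta,\gamma)$, $0\le k\le n$, are defined by the polynomial identity $(t|\alpha)_n=\sum_{k=0}^{n}S(n,k,\alpha,\beta,\gamma)(t-\gamma|\beta)_k$. For a number $\lambda$ and integer $k\ge0$, $\binom{k+\lambda-1}{k}=\lambda(\lambda+1)\cdots(\lambda+k-1)/k!$ (equal to $1$ for $k=0$). Define $$A^{\lambda,x}_n(\alpha,\beta,\gamma)=\sum_{k=0}^{n}\binom{k+\lambda-1}{k}(-1)^{n+k}\beta^k k!\,S(n,k,\alpha,-\beta,-\gamma)\,x^k.$$ For $\alpha\neq0$ these have exponential generating function $\sum_{n\ge0}A^{\lambda,x}_n(\alpha,\beta,\gamma)\frac{t^n}{n!}=(1-\alpha t)^{ -\gamma/\alpha}\bigl[1-x((1-\alpha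 t)^{ -\beta/\alpha}-1)\bigr]^{ -\lambda}$. -}

module Defs where

open import Algebra.Bundles using (CommutativeRing)
import Level
open import Data.Nat using (ℕ; zero; suc) renaming (_+_ to _+ℕ_)

-- Everything is stated over an arbitrary commutative ring R (this covers ℝ and ℂ).
module GenStirling {c ℓ} (R : CommutativeRing c ℓ) where
  open CommutativeRing R hiding (zero)

  fromℕ : ℕ → Carrier
  fromℕ zero    = 0#
  fromℕ (suc n) = 1# + fromℕ n

  pow : Carrier → ℕ → Carrier
  pow a zero    = 1#
  pow a (suc n) = pow a n * a

  negOnePow : ℕ → Carrier
  negOnePow m = pow (- 1#) m

  -- formal polynomials in t over R, as coefficient sequences (coefficient of t^i)
  Poly : Set c
  Poly = ℕ → Carrier

  onePoly : Poly
  onePoly zero    = 1#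
  onePoly (suc _) = 0#

  -- p(t) ↦ p(t) · (t - a)
  mulLin : Carrier → Poly → Poly
  mulLin a p zero    = - (a * p zero)
  mulLin a p (suc i) = p i - a * p (suc i)

  -- shifted generalised falling factorial  (t - γ | β)_k = ∏_{j<k} (t - γ - jβ)
  ffShift : Carrier → Carrier → ℕ → Poly
  ffShift γ β zero    = onePoly
  ffShift γ β (suc k) = mulLin (γ + fromℕ k * β) (ffShift γ β k)

  ff : Carrier → ℕ → Poly
  ff α n = ffShift 0# α n

  sumTo : ℕ → (ℕ → Carrier) → Carrier
  sumTo zero    f = f zero
  sumTo (suc n) f = sumTo n f + f (suc n)

  IsGenStirling : (ℕ → ℕ → Carrier → Carrier → Carrier → Carrier) → Set (c Level.⊔ ℓ)
  IsGenStirling S = ∀ n α β γ (i : ℕ) →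
    ff α n i ≈ sumTo n (λ k → S n k α β γ * ffShift γ β k i)

  -- rising factorial λ(λ+1)⋯(λ+k-1) = binom(k+λ-1, k) · k!
  rising : Carrier → ℕ → Carrier
  rising lam zero    = 1#
  rising lam (suc k) = rising lam k * (lam + fromℕ k)

  A : (ℕ → ℕ → Carrier → Carrier → Carrier → Carrier) →
      Carrier → Carrier → ℕ → Carrier → Carrier → Carrier → Carrier
  A S lam x n α β γ =
    sumTo n (λ k → rising lam k * negOnePow (n +ℕ k) * pow β k
                     * S n k α (- β) (- γ) * pow x k)

module Submission where

-- Write r_λ(k) = λ(λ+1)⋯(λ+k-1) and B(n,k) = (-1)^{n+k} β^k S(n,k,α,-β,-γ), so
-- that A^{λ,x}_n(α,β,γ) = Σ_k r_λ(k) B(n,k) x^k.  The proof never uses generating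
-- functions; it works with the coefficient sequences B(n,·) directly.
--
--  1. Expanding in a unitriangular basis is unique, and (t|α)_{n+1} = (t|α)_n (t - nα)
--     gives an explicit recursion for the connection coefficients between the bases
--     (t|α)_n and (t-g|b)_k.  Hence S agrees with this recursion, and B(n,·) obeys
--     B(n+1,·) = E_{γ+nα} B(n,·), where E_c u (k) = β u(k-1) + (c + kβ) u(k).
--  2. The operators E_c commute with each other, and E_{c+β} D = D E_c for
--     D u (k) = u(k) + (k+1) u(k+1).  So shifting γ by -α prepends a factor E_{γ-α}
--     and shifting γ by β applies D.
--  3. Two summation identities for Σ_k r_λ(k) u(k) x^k, valid for every finitely
--     supported u, turn these operator identities into the two recurrences; they
--     only need r_λ(k+1) = λ r_{λ+1}(k) and r_{λ+1}(k+1) - r_λ(k+1) = (k+1) r_{λ+1}(k).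

open import Defs
open import Algebra.Bundles using (CommutativeRing)
open import Algebra.Solver.Ring.AlmostCommutativeRing
  using (_-Raw-AlmostCommutative⟶_; fromCommutativeRing)
open import Data.Maybe using (Maybe; just; nothing)
open import Data.Nat as ℕ using (ℕ; zero; suc; _≤_; _<_; z≤n; s≤s)
import Data.Nat.Properties as ℕP
open import Data.Integer as ℤ using (ℤ; +_; -[1+_]; _◃_; sign; ∣_∣; _⊖_)
import Data.Integer.Properties as ℤP
open import Data.Product using (_×_; _,_)
open import Data.Sign as Sign using (Sign)
open import Data.Sum using (inj₁; inj₂)
open import Relation.Binary.PropositionalEquality as P using (_≡_)
open import Relation.Nullary using (yes; no)

-- The constants 0 and 1 are interpreted as 0# and 1# on the
-- nose, so solved equations can be used directly in goals.
module IntegerCoefficientSolver {c ℓ} (R : CommutativeRing c ℓ) where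
  open CommutativeRing R
  open import Algebra.Properties.Ring ring using (-‿involutive; -0#≈0#; -1*x≈-x; -‿+-comm)
  open import Algebra.Properties.Semiring.Mult.TCOptimised semiring using (×1-homo-*; ×-homo-+; 1+×)
    renaming (_×_ to _×′_)
  open import Relation.Binary.Reasoning.Setoid setoid

  ⟦_⟧ℤ : ℤ → Carrier
  ⟦ + n ⟧ℤ      = n ×′ 1#
  ⟦ -[1+ n ] ⟧ℤ = - (suc n ×′ 1#)

  private
    -- ℤ multiplies via signs and absolute values, so *-homo goes through them.
    σ : Sign → Carrier
    σ Sign.+ = 1#
    σ Sign.- = - 1#

    σ-* : ∀ s t → σ (s Sign.* t) ≈ σ s * σ t
    σ-* Sign.+ Sign.+ = sym (*-identityˡ _)
    σ-* Sign.+ Sign.- = sym (*-identityˡ _)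
    σ-* Sign.- Sign.+ = sym (*-identityʳ _)
    σ-* Sign.- Sign.- = sym (trans (-1*x≈-x _) (-‿involutive _))

    ◃-homo : ∀ s n → ⟦ s ◃ n ⟧ℤ ≈ σ s * (n ×′ 1#)
    ◃-homo s      zero    = sym (zeroʳ _)
    ◃-homo Sign.+ (suc n) = sym (*-identityˡ _)
    ◃-homo Sign.- (suc n) = sym (-1*x≈-x _)

    sign-abs : ∀ i → ⟦ i ⟧ℤ ≈ σ (sign i) * (∣ i ∣ ×′ 1#)
    sign-abs (+ n)    = sym (*-identityˡ _)
    sign-abs -[1+ n ] = sym (-1*x≈-x _)

    interchange : ∀ a b x y → (a * b) * (x * y) ≈ (a * x) * (b * y)
    interchange a b x y = begin
      (a * b) * (x * y) ≈⟨ *-assoc a b (x * y) ⟩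
      a * (b * (x * y)) ≈⟨ *-congˡ (trans (sym (*-assoc b x y)) (*-congʳ (*-comm b x))) ⟩
      a * ((x * b) * y) ≈⟨ trans (*-congˡ (*-assoc x b y)) (sym (*-assoc a x (b * y))) ⟩
      (a * x) * (b * y) ∎

    *-homo : ∀ i j → ⟦ i ℤ.* j ⟧ℤ ≈ ⟦ i ⟧ℤ * ⟦ j ⟧ℤ
    *-homo i j = begin
      ⟦ sign i Sign.* sign j ◃ ∣ i ∣ ℕ.* ∣ j ∣ ⟧ℤ
        ≈⟨ ◃-homo (sign i Sign.* sign j) (∣ i ∣ ℕ.* ∣ j ∣) ⟩
      σ (sign i Sign.* sign j) * ((∣ i ∣ ℕ.* ∣ j ∣) ×′ 1#)
        ≈⟨ *-cong (σ-* (sign i) (sign j)) (×1-homo-* ∣ i ∣ ∣ j ∣) ⟩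
      (σ (sign i) * σ (sign j)) * ((∣ i ∣ ×′ 1#) * (∣ j ∣ ×′ 1#))
        ≈⟨ interchange _ _ _ _ ⟩
      (σ (sign i) * (∣ i ∣ ×′ 1#)) * (σ (sign j) * (∣ j ∣ ×′ 1#))
        ≈⟨ sym (*-cong (sign-abs i) (sign-abs j)) ⟩
      ⟦ i ⟧ℤ * ⟦ j ⟧ℤ ∎

    neg-homo : ∀ i → ⟦ ℤ.- i ⟧ℤ ≈ - ⟦ i ⟧ℤ
    neg-homo (+ zero)  = sym -0#≈0#
    neg-homo (+ suc n) = refl
    neg-homo -[1+ n ]  = sym (-‿involutive _)

    cancel : ∀ a b e → (a + b) - (a + e) ≈ b - e
    cancel a b e = begin
      (a + b) + - (a + e)   ≈⟨ +-congˡ (sym (-‿+-comm a e)) ⟩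
      (a + b) + (- a + - e) ≈⟨ +-assoc a b _ ⟩
      a + (b + (- a + - e)) ≈⟨ +-congˡ (trans (sym (+-assoc b _ _)) (+-congʳ (+-comm b _))) ⟩
      a + ((- a + b) + - e) ≈⟨ trans (+-congˡ (+-assoc _ b _)) (sym (+-assoc a _ _)) ⟩
      (a + - a) + (b + - e) ≈⟨ trans (+-congʳ (-‿inverseʳ a)) (+-identityˡ _) ⟩
      b - e ∎

    -- Mixed-sign addition is computed by ⊖.
    ⊖-homo : ∀ m n → ⟦ m ⊖ n ⟧ℤ ≈ m ×′ 1# - n ×′ 1#
    ⊖-homo zero    zero    = sym (-‿inverseʳ _)
    ⊖-homo zero    (suc n) = sym (+-identityˡ _)
    ⊖-homo (suc m) zero    = sym (trans (+-congˡ -0#≈0#) (+-identityʳ _))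
    ⊖-homo (suc m) (suc n) = begin
      ⟦ suc m ⊖ suc n ⟧ℤ               ≡⟨ P.cong ⟦_⟧ℤ (ℤP.[1+m]⊖[1+n]≡m⊖n m n) ⟩
      ⟦ m ⊖ n ⟧ℤ                       ≈⟨ ⊖-homo m n ⟩
      m ×′ 1# - n ×′ 1#                ≈⟨ sym (cancel 1# _ _) ⟩
      (1# + m ×′ 1#) - (1# + n ×′ 1#)  ≈⟨ sym (+-cong (1+× m 1#) (-‿cong (1+× n 1#))) ⟩
      suc m ×′ 1# - suc n ×′ 1#        ∎

    +-homo : ∀ i j → ⟦ i ℤ.+ j ⟧ℤ ≈ ⟦ i ⟧ℤ + ⟦ j ⟧ℤ
    +-homo (+ m)    (+ n)    = ×-homo-+ 1# m n
    +-homo (+ m)    -[1+ n ] = ⊖-homo m (suc n)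
    +-homo -[1+ m ] (+ n)    = trans (⊖-homo n (suc m)) (+-comm _ _)
    +-homo -[1+ m ] -[1+ n ] = begin
      - (suc (suc (m ℕ.+ n)) ×′ 1#)      ≡⟨ P.cong (λ k → - (k ×′ 1#)) (P.sym (ℕP.+-suc (suc m) n)) ⟩
      - ((suc m ℕ.+ suc n) ×′ 1#)        ≈⟨ -‿cong (×-homo-+ 1# (suc m) (suc n)) ⟩
      - (suc m ×′ 1# + suc n ×′ 1#)      ≈⟨ sym (-‿+-comm _ _) ⟩
      - (suc m ×′ 1#) + - (suc n ×′ 1#)  ∎

    morphism : ℤ.+-*-rawRing -Raw-AlmostCommutative⟶ fromCommutativeRing R
    morphism = record
      { ⟦_⟧ = ⟦_⟧ℤ ; +-homo = +-homo ; *-homo = *-homo ; -‿homo = neg-homo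
      ; 0-homo = refl ; 1-homo = refl }

    coefficient-equality : ∀ i j → Maybe (⟦ i ⟧ℤ ≈ ⟦ j ⟧ℤ)
    coefficient-equality i j with i ℤ.≟ j
    ... | yes P.refl = just refl
    ... | no _       = nothing

  open import Algebra.Solver.Ring ℤ.+-*-rawRing (fromCommutativeRing R) morphism coefficient-equality public


module StirlingEulerian {c ℓ} (R : CommutativeRing c ℓ) where
  open CommutativeRing R hiding (zero)
  open GenStirling R
  open IntegerCoefficientSolver R using (solve; _:=_; _:+_; _:*_; _:-_; :-_; con)
  open import Algebra.Properties.Group +-group using () renaming (∙-cancelʳ to +-cancelʳ)
  open import Algebra.Properties.CommutativeSemigroup *-commutativeSemigroup using (x∙yz≈y∙xz)
  open import Relation.Binary.Reasoning.Setoid setoid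

  sum-cong : ∀ n {f g : ℕ → Carrier} → (∀ k → k ≤ n → f k ≈ g k) → sumTo n f ≈ sumTo n g
  sum-cong zero    f≈g = f≈g 0 z≤n
  sum-cong (suc n) f≈g =
    +-cong (sum-cong n (λ k k≤n → f≈g k (ℕP.m≤n⇒m≤1+n k≤n))) (f≈g (suc n) ℕP.≤-refl)

  sum-zero : ∀ n {f : ℕ → Carrier} → (∀ k → k ≤ n → f k ≈ 0#) → sumTo n f ≈ 0#
  sum-zero zero    f≈0 = f≈0 0 z≤n
  sum-zero (suc n) f≈0 = begin
    sumTo n _ + _ ≈⟨ +-cong (sum-zero n (λ k k≤n → f≈0 k (ℕP.m≤n⇒m≤1+n k≤n))) (f≈0 (suc n) ℕP.≤-refl) ⟩
    0# + 0#       ≈⟨ +-identityˡ 0# ⟩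
    0#            ∎

  sum-+ : ∀ n (f g : ℕ → Carrier) → sumTo n (λ k → f k + g k) ≈ sumTo n f + sumTo n g
  sum-+ zero    f g = refl
  sum-+ (suc n) f g = trans (+-congʳ (sum-+ n f g))
    (solve 4 (λ a b d e → (a :+ b) :+ (d :+ e) := (a :+ d) :+ (b :+ e)) refl _ _ _ _)

  sum-*ˡ : ∀ n a (f : ℕ → Carrier) → a * sumTo n f ≈ sumTo n (λ k → a * f k)
  sum-*ˡ zero    a f = refl
  sum-*ˡ (suc n) a f = trans (distribˡ a _ _) (+-congʳ (sum-*ˡ n a f))

  sum-linear : ∀ n a b (f g : ℕ → Carrier) →
    sumTo n (λ k → a * f k + b * g k) ≈ a * sumTo n f + b * sumTo n g
  sum-linear n a b f g = trans (sum-+ n _ _) (sym (+-cong (sum-*ˡ n a f) (sum-*ˡ n b g)))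

  sum-first : ∀ n (f : ℕ → Carrier) → sumTo (suc n) f ≈ f 0 + sumTo n (λ k → f (suc k))
  sum-first zero    f = refl
  sum-first (suc n) f = trans (+-congʳ (sum-first n f)) (+-assoc _ _ _)

  sum-shift : ∀ n (f : ℕ → Carrier) → f 0 ≈ 0# → f (suc n) ≈ 0# →
    sumTo n (λ k → f (suc k)) ≈ sumTo n f
  sum-shift n f f0≈0 fn≈0 = begin
    sumTo n (λ k → f (suc k))        ≈⟨ sym (+-identityˡ _) ⟩
    0# + sumTo n (λ k → f (suc k))   ≈⟨ +-congʳ (sym f0≈0) ⟩
    f 0 + sumTo n (λ k → f (suc k))  ≈⟨ sym (sum-first n f) ⟩
    sumTo n f + f (suc n)            ≈⟨ +-congˡ fn≈0 ⟩
    sumTo n f + 0#                   ≈⟨ +-identityʳ _ ⟩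
    sumTo n f                        ∎

  VanishesAbove : ℕ → (ℕ → Carrier) → Set ℓ
  VanishesAbove n u = ∀ k → n < k → u k ≈ 0#

  prev : (ℕ → Carrier) → ℕ → Carrier
  prev u zero    = 0#
  prev u (suc k) = u k

  -- k ↦ a·u(k-1) + e(k)·u(k): the effect of multiplication by a linear factor
  -- on coefficients in a falling-factorial-type basis.
  step : Carrier → (ℕ → Carrier) → (ℕ → Carrier) → ℕ → Carrier
  step a e u k = a * prev u k + e k * u k

  step-cong : ∀ a {e e' u u' : ℕ → Carrier} → (∀ k → e k ≈ e' k) → (∀ k → u k ≈ u' k) →
    ∀ k → step a e u k ≈ step a e' u' k
  step-cong a e≈e' u≈u' zero    = +-congˡ (*-cong (e≈e' 0) (u≈u' 0))
  step-cong a e≈e' u≈u' (suc k) = +-cong (*-congˡ (u≈u' k)) (*-cong (e≈e' (suc k)) (u≈u' (suc k)))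

  step-vanishes : ∀ n a e u → VanishesAbove n u → VanishesAbove (suc n) (step a e u)
  step-vanishes n a e u u≈0 (suc k) (s≤s n<k) = begin
    a * u k + e (suc k) * u (suc k) ≈⟨ +-cong (*-congˡ (u≈0 k n<k)) (*-congˡ (u≈0 (suc k) (ℕP.m≤n⇒m≤1+n n<k))) ⟩
    a * 0# + e (suc k) * 0#         ≈⟨ solve 2 (λ a e → a :* con (+ 0) :+ e :* con (+ 0) := con (+ 0)) refl a (e (suc k)) ⟩
    0#                              ∎

  sum-step : ∀ n a e u (w : ℕ → Carrier) → VanishesAbove n u →
    sumTo (suc n) (λ k → step a e u k * w k) ≈ sumTo n (λ k → a * u k * w (suc k) + e k * u k * w k)
  sum-step n a e u w u≈0 = begin
    sumTo (suc n) (λ k → step a e u k * w k)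
      ≈⟨ sum-cong (suc n) (λ k _ → distribʳ (w k) _ _) ⟩
    sumTo (suc n) (λ k → a * prev u k * w k + e k * u k * w k)
      ≈⟨ sum-+ (suc n) _ _ ⟩
    sumTo (suc n) (λ k → a * prev u k * w k) + (sumTo n F + e (suc n) * u (suc n) * w (suc n))
      ≈⟨ +-cong (sum-first n _) (+-congˡ (*-congʳ (*-congˡ (u≈0 (suc n) ℕP.≤-refl)))) ⟩
    (a * 0# * w 0 + sumTo n G) + (sumTo n F + e (suc n) * 0# * w (suc n))
      ≈⟨ solve 6 (λ a w₀ G F e w → (a :* con (+ 0) :* w₀ :+ G) :+ (F :+ e :* con (+ 0) :* w) := G :+ F)
           refl a (w 0) (sumTo n G) (sumTo n F) (e (suc n)) (w (suc n)) ⟩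
    sumTo n G + sumTo n F
      ≈⟨ sym (sum-+ n G F) ⟩
    sumTo n (λ k → a * u k * w (suc k) + e k * u k * w k) ∎
    where
    F G : ℕ → Carrier
    F k = e k * u k * w k
    G k = a * u k * w (suc k)

  module Unitriangular (p : ℕ → Poly)
                       (p-below : ∀ k i → k < i → p k i ≈ 0#)
                       (p-diagonal : ∀ k → p k k ≈ 1#) where

    top-coefficient : ∀ n (u : ℕ → Carrier) → sumTo n (λ k → u k * p k n) ≈ u n
    top-coefficient zero    u = trans (*-congˡ (p-diagonal 0)) (*-identityʳ _)
    top-coefficient (suc n) u = begin
      sumTo n (λ k → u k * p k (suc n)) + u (suc n) * p (suc n) (suc n)
        ≈⟨ +-cong (sum-zero n (λ k k≤n → trans (*-congˡ (p-below k (suc n) (s≤s k≤n))) (zeroʳ _)))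
                  (*-congˡ (p-diagonal (suc n))) ⟩
      0# + u (suc n) * 1#
        ≈⟨ trans (+-identityˡ _) (*-identityʳ _) ⟩
      u (suc n) ∎

    SameExpansion : ℕ → (ℕ → Carrier) → (ℕ → Carrier) → Set ℓ
    SameExpansion n u v = ∀ i → sumTo n (λ k → u k * p k i) ≈ sumTo n (λ k → v k * p k i)

    top-equal : ∀ n u v → SameExpansion n u v → u n ≈ v n
    top-equal n u v same = trans (sym (top-coefficient n u)) (trans (same n) (top-coefficient n v))

    expansion-unique : ∀ n u v → SameExpansion n u v → ∀ k → k ≤ n → u k ≈ v k
    expansion-unique zero    u v same .0 z≤n = top-equal 0 u v same
    expansion-unique (suc n) u v same k k≤1+n with ℕP.m≤n⇒m<n∨m≡n k≤1+n
    ... | inj₂ P.refl    = top-equal (suc n) u v same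
    ... | inj₁ (s≤s k≤n) = expansion-unique n u v lower k k≤n
      where
      lower : SameExpansion n u v
      lower i = +-cancelʳ (u (suc n) * p (suc n) i) _ _
        (trans (same i) (+-congˡ (*-congʳ (sym (top-equal (suc n) u v same)))))

  ffShift-below : ∀ g b k i → k < i → ffShift g b k i ≈ 0#
  ffShift-below g b zero    (suc i) _         = refl
  ffShift-below g b (suc k) (suc i) (s≤s k<i) = begin
    ffShift g b k i - (g + fromℕ k * b) * ffShift g b k (suc i)
      ≈⟨ +-cong (ffShift-below g b k i k<i) (-‿cong (*-congˡ (ffShift-below g b k (suc i) (ℕP.m≤n⇒m≤1+n k<i)))) ⟩
    0# - (g + fromℕ k * b) * 0#
      ≈⟨ solve 1 (λ a → con (+ 0) :- a :* con (+ 0) := con (+ 0)) refl _ ⟩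
    0# ∎

  ffShift-diagonal : ∀ g b k → ffShift g b k k ≈ 1#
  ffShift-diagonal g b zero    = refl
  ffShift-diagonal g b (suc k) = begin
    ffShift g b k k - (g + fromℕ k * b) * ffShift g b k (suc k)
      ≈⟨ +-cong (ffShift-diagonal g b k) (-‿cong (*-congˡ (ffShift-below g b k (suc k) ℕP.≤-refl))) ⟩
    1# - (g + fromℕ k * b) * 0#
      ≈⟨ solve 1 (λ a → con (+ 1) :- a :* con (+ 0) := con (+ 1)) refl _ ⟩
    1# ∎

  mulLin-cong : ∀ a {p q : Poly} → (∀ i → p i ≈ q i) → ∀ i → mulLin a p i ≈ mulLin a q i
  mulLin-cong a p≈q zero    = -‿cong (*-congˡ (p≈q 0))
  mulLin-cong a p≈q (suc i) = +-cong (p≈q i) (-‿cong (*-congˡ (p≈q (suc i))))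

  mulLin-+ : ∀ a (p q : Poly) i → mulLin a (λ j → p j + q j) i ≈ mulLin a p i + mulLin a q i
  mulLin-+ a p q zero    = solve 3 (λ a x y → :- (a :* (x :+ y)) := :- (a :* x) :+ :- (a :* y)) refl a (p 0) (q 0)
  mulLin-+ a p q (suc i) = solve 5 (λ a x y x' y' → (x :+ y) :- a :* (x' :+ y') := (x :- a :* x') :+ (y :- a :* y'))
                             refl a (p i) (q i) (p (suc i)) (q (suc i))

  mulLin-* : ∀ a d (p : Poly) i → mulLin a (λ j → d * p j) i ≈ d * mulLin a p i
  mulLin-* a d p zero    = solve 3 (λ a d x → :- (a :* (d :* x)) := d :* (:- (a :* x))) refl a d (p 0)
  mulLin-* a d p (suc i) = solve 4 (λ a d x x' → d :* x :- a :* (d :* x') := d :* (x :- a :* x'))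
                             refl a d (p i) (p (suc i))

  mulLin-linear : ∀ a n (u : ℕ → Carrier) (p : ℕ → Poly) i →
    mulLin a (λ j → sumTo n (λ k → u k * p k j)) i ≈ sumTo n (λ k → u k * mulLin a (p k) i)
  mulLin-linear a zero    u p i = mulLin-* a (u 0) (p 0) i
  mulLin-linear a (suc n) u p i = trans (mulLin-+ a _ _ i)
    (+-cong (mulLin-linear a n u p i) (mulLin-* a (u (suc n)) (p (suc n)) i))

  mulLin-shift : ∀ a a' (p : Poly) i → mulLin a p i ≈ mulLin a' p i + (a' - a) * p i
  mulLin-shift a a' p zero    = solve 3 (λ a a' x → :- (a :* x) := :- (a' :* x) :+ (a' :- a) :* x) refl a a' (p 0)
  mulLin-shift a a' p (suc i) = solve 4 (λ a a' x x' → x :- a :* x' := (x :- a' :* x') :+ (a' :- a) :* x')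
                                  refl a a' (p i) (p (suc i))

  mulLin-ffShift : ∀ g b c k i →
    mulLin c (ffShift g b k) i ≈ ffShift g b (suc k) i + (g + fromℕ k * b - c) * ffShift g b k i
  mulLin-ffShift g b c k = mulLin-shift c (g + fromℕ k * b) (ffShift g b k)

  -- The step describing multiplication by t - c in the basis (t-g|b)_k.
  rootStep : (g b c : Carrier) → (ℕ → Carrier) → ℕ → Carrier
  rootStep g b c = step 1# (λ k → g + fromℕ k * b - c)

  connection : (g b g' a : Carrier) → ℕ → ℕ → Carrier
  connection g b g' a zero    = onePoly
  connection g b g' a (suc n) = rootStep g b (g' + fromℕ n * a) (connection g b g' a n)

  connection-vanishes : ∀ g b g' a n → VanishesAbove n (connection g b g' a n)
  connection-vanishes g b g' a zero    (suc k) _ = refl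
  connection-vanishes g b g' a (suc n) =
    step-vanishes n 1# _ (connection g b g' a n) (connection-vanishes g b g' a n)

  mulLin-expansion : ∀ g b c n u → VanishesAbove n u → ∀ i →
    mulLin c (λ j → sumTo n (λ k → u k * ffShift g b k j)) i
      ≈ sumTo (suc n) (λ k → rootStep g b c u k * ffShift g b k i)
  mulLin-expansion g b c n u u≈0 i = begin
    mulLin c (λ j → sumTo n (λ k → u k * ffShift g b k j)) i
      ≈⟨ mulLin-linear c n u (ffShift g b) i ⟩
    sumTo n (λ k → u k * mulLin c (ffShift g b k) i)
      ≈⟨ sum-cong n (λ k _ → trans (*-congˡ (mulLin-ffShift g b c k i))
           (solve 4 (λ u p' e p → u :* (p' :+ e :* p) := con (+ 1) :* u :* p' :+ e :* u :* p)
              refl (u k) (ffShift g b (suc k) i) (g + fromℕ k * b - c) (ffShift g b k i))) ⟩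
    sumTo n (λ k → 1# * u k * ffShift g b (suc k) i + (g + fromℕ k * b - c) * u k * ffShift g b k i)
      ≈⟨ sym (sum-step n 1# _ u (λ k → ffShift g b k i) u≈0) ⟩
    sumTo (suc n) (λ k → rootStep g b c u k * ffShift g b k i) ∎

  connection-expansion : ∀ g b g' a n i →
    ffShift g' a n i ≈ sumTo n (λ k → connection g b g' a n k * ffShift g b k i)
  connection-expansion g b g' a zero    i = sym (*-identityˡ _)
  connection-expansion g b g' a (suc n) i = begin
    mulLin (g' + fromℕ n * a) (ffShift g' a n) i
      ≈⟨ mulLin-cong _ (connection-expansion g b g' a n) i ⟩
    mulLin (g' + fromℕ n * a) (λ j → sumTo n (λ k → connection g b g' a n k * ffShift g b k j)) i
      ≈⟨ mulLin-expansion g b _ n _ (connection-vanishes g b g' a n) i ⟩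
    sumTo (suc n) (λ k → connection g b g' a (suc n) k * ffShift g b k i) ∎

  stirling≈connection : ∀ S → IsGenStirling S →
    ∀ n α β γ k → k ≤ n → S n k α β γ ≈ connection γ β 0# α n k
  stirling≈connection S isS n α β γ =
    expansion-unique n _ _ (λ i → trans (sym (isS n α β γ i)) (connection-expansion γ β 0# α n i))
    where open Unitriangular (ffShift γ β) (ffShift-below γ β) (ffShift-diagonal γ β)

  normStep : (β c : Carrier) → (ℕ → Carrier) → ℕ → Carrier
  normStep β c = step β (λ k → c + fromℕ k * β)

  normStep-cong : ∀ β {c c'} {u v : ℕ → Carrier} → c ≈ c' → (∀ k → u k ≈ v k) →
    ∀ k → normStep β c u k ≈ normStep β c' v k
  normStep-cong β c≈c' = step-cong β (λ _ → +-congʳ c≈c')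

  -- B(n,·), defined by its recursion; twisted-connection identifies it with the
  -- sign-twisted Stirling numbers.
  normalised : (α β γ : Carrier) → ℕ → ℕ → Carrier
  normalised α β γ zero    = onePoly
  normalised α β γ (suc n) = normStep β (γ + fromℕ n * α) (normalised α β γ n)

  -- (-1)^{n+k+1} = (-1)^{n+k}·(-1), needed since n + suc k is not suc (n + k) by definition.
  negOnePow-suc : ∀ n k → negOnePow (n ℕ.+ suc k) ≈ negOnePow (n ℕ.+ k) * - 1#
  negOnePow-suc n k = reflexive (P.cong negOnePow (ℕP.+-suc n k))

  twisted-connection : ∀ α β γ n k →
    negOnePow (n ℕ.+ k) * pow β k * connection (- γ) (- β) 0# α n k ≈ normalised α β γ n k
  twisted-connection α β γ zero zero       = solve 0 (con (+ 1) :* con (+ 1) :* con (+ 1) := con (+ 1)) refl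
  twisted-connection α β γ zero (suc k)    = zeroʳ _
  twisted-connection α β γ (suc n) zero    = begin
    negOnePow (n ℕ.+ 0) * - 1# * 1# * (1# * 0# + ((- γ + 0# * - β) - (0# + fromℕ n * α)) * t)
      ≈⟨ solve 6 (λ N g b f a t →
           N :* (:- con (+ 1)) :* con (+ 1) :* (con (+ 1) :* con (+ 0) :+ ((:- g :+ con (+ 0) :* (:- b)) :- (con (+ 0) :+ f :* a)) :* t)
           := b :* con (+ 0) :+ ((g :+ f :* a) :+ con (+ 0) :* b) :* (N :* con (+ 1) :* t))
           refl (negOnePow (n ℕ.+ 0)) γ β (fromℕ n) α t ⟩
    β * 0# + ((γ + fromℕ n * α) + 0# * β) * (negOnePow (n ℕ.+ 0) * 1# * t)
      ≈⟨ +-congˡ (*-congˡ (twisted-connection α β γ n 0)) ⟩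
    β * 0# + ((γ + fromℕ n * α) + 0# * β) * normalised α β γ n 0 ∎
    where
    t : Carrier
    t = connection (- γ) (- β) 0# α n 0
  twisted-connection α β γ (suc n) (suc k) = begin
    negOnePow (n ℕ.+ suc k) * - 1# * (pow β k * β) * (1# * t + e * t')
      ≈⟨ *-congʳ (*-congʳ (*-congʳ (negOnePow-suc n k))) ⟩
    N * - 1# * - 1# * (pow β k * β) * (1# * t + e * t')
      ≈⟨ solve 9 (λ N p b t t' g f f' a →
           N :* (:- con (+ 1)) :* (:- con (+ 1)) :* (p :* b)
             :* (con (+ 1) :* t :+ ((:- g :+ (con (+ 1) :+ f) :* (:- b)) :- (con (+ 0) :+ f' :* a)) :* t')
           := b :* (N :* p :* t) :+ ((g :+ f' :* a) :+ (con (+ 1) :+ f) :* b) :* (N :* (:- con (+ 1)) :* (p :* b) :* t'))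
           refl N (pow β k) β t t' γ (fromℕ k) (fromℕ n) α ⟩
    β * (N * pow β k * t) + c' * (N * - 1# * (pow β k * β) * t')
      ≈⟨ +-cong (*-congˡ (twisted-connection α β γ n k))
                (*-congˡ (trans (*-congʳ (*-congʳ (sym (negOnePow-suc n k)))) (twisted-connection α β γ n (suc k)))) ⟩
    β * normalised α β γ n k + c' * normalised α β γ n (suc k) ∎
    where
    N t t' e c' : Carrier
    N  = negOnePow (n ℕ.+ k)
    t  = connection (- γ) (- β) 0# α n k
    t' = connection (- γ) (- β) 0# α n (suc k)
    e  = (- γ + fromℕ (suc k) * - β) - (0# + fromℕ n * α)
    c' = (γ + fromℕ n * α) + fromℕ (suc k) * β

  normalised-vanishes : ∀ α β γ n → VanishesAbove n (normalised α β γ n)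
  normalised-vanishes α β γ zero    (suc k) _ = refl
  normalised-vanishes α β γ (suc n) =
    step-vanishes n β _ (normalised α β γ n) (normalised-vanishes α β γ n)

  risingSum : Carrier → Carrier → ℕ → (ℕ → Carrier) → Carrier
  risingSum lam x n u = sumTo n (λ k → rising lam k * u k * pow x k)

  risingSum-cong : ∀ lam x n {u v : ℕ → Carrier} → (∀ k → u k ≈ v k) →
    risingSum lam x n u ≈ risingSum lam x n v
  risingSum-cong lam x n u≈v = sum-cong n (λ k _ → *-congʳ (*-congˡ (u≈v k)))

  A≈risingSum : ∀ S → IsGenStirling S → ∀ lam x n α β γ →
    A S lam x n α β γ ≈ risingSum lam x n (normalised α β γ n)
  A≈risingSum S isS lam x n α β γ = sum-cong n (λ k k≤n → begin
    rising lam k * negOnePow (n ℕ.+ k) * pow β k * S n k α (- β) (- γ) * pow x k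
      ≈⟨ *-congʳ (*-congˡ (stirling≈connection S isS n α (- β) (- γ) k k≤n)) ⟩
    rising lam k * negOnePow (n ℕ.+ k) * pow β k * connection (- γ) (- β) 0# α n k * pow x k
      ≈⟨ *-congʳ (trans (*-assoc _ _ _) (trans (*-assoc _ _ _) (*-congˡ (sym (*-assoc _ _ _))))) ⟩
    rising lam k * (negOnePow (n ℕ.+ k) * pow β k * connection (- γ) (- β) 0# α n k) * pow x k
      ≈⟨ *-congʳ (*-congˡ (twisted-connection α β γ n k)) ⟩
    rising lam k * normalised α β γ n k * pow x k ∎)

  normStep-comm : ∀ β c c' u k → normStep β c (normStep β c' u) k ≈ normStep β c' (normStep β c u) k
  normStep-comm β c c' u zero = solve 4 (λ b c c' u →
      b :* con (+ 0) :+ (c :+ con (+ 0) :* b) :* (b :* con (+ 0) :+ (c' :+ con (+ 0) :* b) :* u)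
      := b :* con (+ 0) :+ (c' :+ con (+ 0) :* b) :* (b :* con (+ 0) :+ (c :+ con (+ 0) :* b) :* u))
    refl β c c' (u 0)
  normStep-comm β c c' u (suc zero) = solve 5 (λ b c c' u₀ u₁ →
      b :* (b :* con (+ 0) :+ (c' :+ con (+ 0) :* b) :* u₀) :+ (c :+ (con (+ 1) :+ con (+ 0)) :* b) :* (b :* u₀ :+ (c' :+ (con (+ 1) :+ con (+ 0)) :* b) :* u₁)
      := b :* (b :* con (+ 0) :+ (c :+ con (+ 0) :* b) :* u₀) :+ (c' :+ (con (+ 1) :+ con (+ 0)) :* b) :* (b :* u₀ :+ (c :+ (con (+ 1) :+ con (+ 0)) :* b) :* u₁))
    refl β c c' (u 0) (u 1)
  normStep-comm β c c' u (suc (suc k)) = solve 7 (λ b c c' f u₀ u₁ u₂ →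
      b :* (b :* u₀ :+ (c' :+ (con (+ 1) :+ f) :* b) :* u₁) :+ (c :+ (con (+ 1) :+ (con (+ 1) :+ f)) :* b) :* (b :* u₁ :+ (c' :+ (con (+ 1) :+ (con (+ 1) :+ f)) :* b) :* u₂)
      := b :* (b :* u₀ :+ (c :+ (con (+ 1) :+ f) :* b) :* u₁) :+ (c' :+ (con (+ 1) :+ (con (+ 1) :+ f)) :* b) :* (b :* u₁ :+ (c :+ (con (+ 1) :+ (con (+ 1) :+ f)) :* b) :* u₂))
    refl β c c' (fromℕ k) (u k) (u (suc k)) (u (suc (suc k)))

  derivative : (ℕ → Carrier) → ℕ → Carrier
  derivative u k = u k + fromℕ (suc k) * u (suc k)

  normStep-derivative : ∀ β c u k → normStep β (c + β) (derivative u) k ≈ derivative (normStep β c u) k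
  normStep-derivative β c u zero = solve 4 (λ b c u₀ u₁ →
      b :* con (+ 0) :+ ((c :+ b) :+ con (+ 0) :* b) :* (u₀ :+ (con (+ 1) :+ con (+ 0)) :* u₁)
      := (b :* con (+ 0) :+ (c :+ con (+ 0) :* b) :* u₀) :+ (con (+ 1) :+ con (+ 0)) :* (b :* u₀ :+ (c :+ (con (+ 1) :+ con (+ 0)) :* b) :* u₁))
    refl β c (u 0) (u 1)
  normStep-derivative β c u (suc k) = solve 6 (λ b c f u₀ u₁ u₂ →
      b :* (u₀ :+ (con (+ 1) :+ f) :* u₁) :+ ((c :+ b) :+ (con (+ 1) :+ f) :* b) :* (u₁ :+ (con (+ 1) :+ (con (+ 1) :+ f)) :* u₂)
      := (b :* u₀ :+ (c :+ (con (+ 1) :+ f) :* b) :* u₁) :+ (con (+ 1) :+ (con (+ 1) :+ f)) :* (b :* u₁ :+ (c :+ (con (+ 1) :+ (con (+ 1) :+ f)) :* b) :* u₂))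
    refl β c (fromℕ k) (u k) (u (suc k)) (u (suc (suc k)))

  normalised-shift-β : ∀ α β γ n k → normalised α β (γ + β) n k ≈ derivative (normalised α β γ n) k
  normalised-shift-β α β γ zero zero    = solve 0 (con (+ 1) := con (+ 1) :+ (con (+ 1) :+ con (+ 0)) :* con (+ 0)) refl
  normalised-shift-β α β γ zero (suc k) = solve 1 (λ f → con (+ 0) := con (+ 0) :+ f :* con (+ 0)) refl (fromℕ (suc (suc k)))
  normalised-shift-β α β γ (suc n) k = begin
    normStep β ((γ + β) + fromℕ n * α) (normalised α β (γ + β) n) k
      ≈⟨ normStep-cong β (solve 4 (λ g b f a → (g :+ b) :+ f :* a := (g :+ f :* a) :+ b) refl γ β (fromℕ n) α)
                         (normalised-shift-β α β γ n) k ⟩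
    normStep β ((γ + fromℕ n * α) + β) (derivative (normalised α β γ n)) k
      ≈⟨ normStep-derivative β (γ + fromℕ n * α) (normalised α β γ n) k ⟩
    derivative (normalised α β γ (suc n)) k ∎

  normalised-shift-α : ∀ α β γ n k → normalised α β (γ - α) (suc n) k ≈ normStep β (γ - α) (normalised α β γ n) k
  normalised-shift-α α β γ zero = normStep-cong β (solve 2 (λ g a → (g :- a) :+ con (+ 0) :* a := g :- a) refl γ α) (λ _ → refl)
  normalised-shift-α α β γ (suc n) k = begin
    normStep β ((γ - α) + fromℕ (suc n) * α) (normalised α β (γ - α) (suc n)) k
      ≈⟨ normStep-cong β (solve 3 (λ g a f → (g :- a) :+ (con (+ 1) :+ f) :* a := g :+ f :* a) refl γ α (fromℕ n))
                         (normalised-shift-α α β γ n) k ⟩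
    normStep β (γ + fromℕ n * α) (normStep β (γ - α) (normalised α β γ n)) k
      ≈⟨ normStep-comm β (γ + fromℕ n * α) (γ - α) (normalised α β γ n) k ⟩
    normStep β (γ - α) (normalised α β γ (suc n)) k ∎

  rising-succ : ∀ lam k → rising lam (suc k) ≈ lam * rising (lam + 1#) k
  rising-succ lam zero    = solve 1 (λ l → con (+ 1) :* (l :+ con (+ 0)) := l :* con (+ 1)) refl lam
  rising-succ lam (suc k) = begin
    rising lam (suc k) * (lam + fromℕ (suc k))
      ≈⟨ *-congʳ (rising-succ lam k) ⟩
    lam * rising (lam + 1#) k * (lam + (1# + fromℕ k))
      ≈⟨ solve 3 (λ l r f → l :* r :* (l :+ (con (+ 1) :+ f)) := l :* (r :* ((l :+ con (+ 1)) :+ f)))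
           refl lam (rising (lam + 1#) k) (fromℕ k) ⟩
    lam * rising (lam + 1#) (suc k) ∎

  -- The difference r_{λ+1} - r_λ, which produces the factor k+1 of D in derivative-sum.
  rising-difference : ∀ lam k → rising (lam + 1#) (suc k) - rising lam (suc k) ≈ fromℕ (suc k) * rising (lam + 1#) k
  rising-difference lam k = begin
    rising (lam + 1#) k * ((lam + 1#) + fromℕ k) - rising lam (suc k)
      ≈⟨ +-congˡ (-‿cong (rising-succ lam k)) ⟩
    rising (lam + 1#) k * ((lam + 1#) + fromℕ k) - lam * rising (lam + 1#) k
      ≈⟨ solve 3 (λ r l f → r :* ((l :+ con (+ 1)) :+ f) :- l :* r := (con (+ 1) :+ f) :* r)
           refl (rising (lam + 1#) k) lam (fromℕ k) ⟩
    fromℕ (suc k) * rising (lam + 1#) k ∎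

  -- k·r_λ(k) = λ(r_{λ+1}(k) - r_λ(k)): absorbs the kβ term of E_c in normStep-sum.
  rising-weight : ∀ lam k → fromℕ k * rising lam k ≈ lam * (rising (lam + 1#) k - rising lam k)
  rising-weight lam zero    = solve 1 (λ l → con (+ 0) :* con (+ 1) := l :* (con (+ 1) :- con (+ 1))) refl lam
  rising-weight lam (suc k) = begin
    fromℕ (suc k) * rising lam (suc k)          ≈⟨ *-congˡ (rising-succ lam k) ⟩
    fromℕ (suc k) * (lam * rising (lam + 1#) k) ≈⟨ x∙yz≈y∙xz _ _ _ ⟩
    lam * (fromℕ (suc k) * rising (lam + 1#) k) ≈⟨ *-congˡ (sym (rising-difference lam k)) ⟩
    lam * (rising (lam + 1#) (suc k) - rising lam (suc k)) ∎

  derivative-sum : ∀ lam x n u → VanishesAbove n u →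
    x * risingSum (lam + 1#) x n (derivative u) ≈ (x + 1#) * risingSum (lam + 1#) x n u - risingSum lam x n u
  derivative-sum lam x n u u≈0 = begin
    x * risingSum (lam + 1#) x n (derivative u)
      ≈⟨ sum-*ˡ n x _ ⟩
    sumTo n (λ k → x * (r₁ k * derivative u k * pow x k))
      ≈⟨ sum-cong n (λ k _ → split k) ⟩
    sumTo n (λ k → U k + W (suc k))
      ≈⟨ sum-+ n U (λ k → W (suc k)) ⟩
    sumTo n U + sumTo n (λ k → W (suc k))
      ≈⟨ +-congˡ (sum-shift n W W₀≈0 Wtop≈0) ⟩
    sumTo n U + sumTo n W
      ≈⟨ sym (sum-+ n U W) ⟩
    sumTo n (λ k → U k + W k)
      ≈⟨ sum-cong n (λ k _ → solve 5 (λ x r₁ r₀ u X →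
           x :* (r₁ :* u :* X) :+ (r₁ :- r₀) :* u :* X
           := (x :+ con (+ 1)) :* (r₁ :* u :* X) :+ (:- con (+ 1)) :* (r₀ :* u :* X))
           refl x (r₁ k) (r₀ k) (u k) (pow x k)) ⟩
    sumTo n (λ k → (x + 1#) * (r₁ k * u k * pow x k) + - 1# * (r₀ k * u k * pow x k))
      ≈⟨ sum-linear n (x + 1#) (- 1#) _ _ ⟩
    (x + 1#) * risingSum (lam + 1#) x n u + - 1# * risingSum lam x n u
      ≈⟨ solve 3 (λ y M N → y :* M :+ (:- con (+ 1)) :* N := y :* M :- N) refl (x + 1#) _ _ ⟩
    (x + 1#) * risingSum (lam + 1#) x n u - risingSum lam x n u ∎
    where
    r₀ r₁ U W : ℕ → Carrier
    r₀ = rising lam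
    r₁ = rising (lam + 1#)
    U k = x * (r₁ k * u k * pow x k)
    W k = (r₁ k - r₀ k) * u k * pow x k

    W₀≈0 : W 0 ≈ 0#
    W₀≈0 = solve 1 (λ u → (con (+ 1) :- con (+ 1)) :* u :* con (+ 1) := con (+ 0)) refl (u 0)

    Wtop≈0 : W (suc n) ≈ 0#
    Wtop≈0 = trans (*-congʳ (trans (*-congˡ (u≈0 (suc n) ℕP.≤-refl)) (zeroʳ _))) (zeroˡ _)

    split : ∀ k → x * (r₁ k * derivative u k * pow x k) ≈ U k + W (suc k)
    split k = begin
      x * (r₁ k * (u k + fromℕ (suc k) * u (suc k)) * pow x k)
        ≈⟨ solve 6 (λ x r u u' f X →
             x :* (r :* (u :+ f :* u') :* X) := x :* (r :* u :* X) :+ f :* r :* u' :* (X :* x))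
             refl x (r₁ k) (u k) (u (suc k)) (fromℕ (suc k)) (pow x k) ⟩
      U k + fromℕ (suc k) * r₁ k * u (suc k) * pow x (suc k)
        ≈⟨ +-congˡ (*-congʳ (*-congʳ (sym (rising-difference lam k)))) ⟩
      U k + W (suc k) ∎

  normStep-sum : ∀ lam x β c n u → VanishesAbove n u →
    risingSum lam x (suc n) (normStep β c u)
      ≈ (x + 1#) * lam * β * risingSum (lam + 1#) x n u + (c - lam * β) * risingSum lam x n u
  normStep-sum lam x β c n u u≈0 = begin
    risingSum lam x (suc n) (normStep β c u)
      ≈⟨ sum-cong (suc n) (λ k _ → solve 3 (λ r s X → r :* s :* X := s :* (r :* X)) refl (r₀ k) _ (pow x k)) ⟩
    sumTo (suc n) (λ k → normStep β c u k * (r₀ k * pow x k))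
      ≈⟨ sum-step n β _ u (λ k → r₀ k * pow x k) u≈0 ⟩
    sumTo n (λ k → β * u k * (r₀ (suc k) * pow x (suc k)) + (c + fromℕ k * β) * u k * (r₀ k * pow x k))
      ≈⟨ sum-cong n (λ k _ → combine k) ⟩
    sumTo n (λ k → (x + 1#) * lam * β * (r₁ k * u k * pow x k) + (c - lam * β) * (r₀ k * u k * pow x k))
      ≈⟨ sum-linear n _ _ _ _ ⟩
    (x + 1#) * lam * β * risingSum (lam + 1#) x n u + (c - lam * β) * risingSum lam x n u ∎
    where
    r₀ r₁ : ℕ → Carrier
    r₀ = rising lam
    r₁ = rising (lam + 1#)

    combine : ∀ k → β * u k * (r₀ (suc k) * pow x (suc k)) + (c + fromℕ k * β) * u k * (r₀ k * pow x k)
                    ≈ (x + 1#) * lam * β * (r₁ k * u k * pow x k) + (c - lam * β) * (r₀ k * u k * pow x k)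
    combine k = begin
      β * u k * (r₀ (suc k) * (X * x)) + (c + fromℕ k * β) * u k * (r₀ k * X)
        ≈⟨ +-congʳ (*-congˡ (*-congʳ (rising-succ lam k))) ⟩
      β * u k * (lam * r₁ k * (X * x)) + (c + fromℕ k * β) * u k * (r₀ k * X)
        ≈⟨ solve 9 (λ b u l r₁ r₀ X x c f →
             b :* u :* (l :* r₁ :* (X :* x)) :+ (c :+ f :* b) :* u :* (r₀ :* X)
             := b :* u :* (l :* r₁ :* (X :* x)) :+ c :* u :* (r₀ :* X) :+ b :* u :* X :* (f :* r₀))
             refl β (u k) lam (r₁ k) (r₀ k) X x c (fromℕ k) ⟩
      β * u k * (lam * r₁ k * (X * x)) + c * u k * (r₀ k * X) + β * u k * X * (fromℕ k * r₀ k)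
        ≈⟨ +-congˡ (*-congˡ (rising-weight lam k)) ⟩
      β * u k * (lam * r₁ k * (X * x)) + c * u k * (r₀ k * X) + β * u k * X * (lam * (r₁ k - r₀ k))
        ≈⟨ solve 8 (λ b u l r₁ r₀ X x c →
             b :* u :* (l :* r₁ :* (X :* x)) :+ c :* u :* (r₀ :* X) :+ b :* u :* X :* (l :* (r₁ :- r₀))
             := (x :+ con (+ 1)) :* l :* b :* (r₁ :* u :* X) :+ (c :- l :* b) :* (r₀ :* u :* X))
             refl β (u k) lam (r₁ k) (r₀ k) X x c ⟩
      (x + 1#) * lam * β * (r₁ k * u k * X) + (c - lam * β) * (r₀ k * u k * X) ∎
      where
      X : Carrier
      X = pow x k

  recurrence-β : ∀ S → IsGenStirling S → ∀ α β γ x lam n →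
    x * A S (lam + 1#) x n α β (γ + β) ≈ (x + 1#) * A S (lam + 1#) x n α β γ - A S lam x n α β γ
  recurrence-β S isS α β γ x lam n = begin
    x * A S (lam + 1#) x n α β (γ + β)
      ≈⟨ *-congˡ (trans (A≈risingSum S isS (lam + 1#) x n α β (γ + β))
                        (risingSum-cong (lam + 1#) x n (normalised-shift-β α β γ n))) ⟩
    x * risingSum (lam + 1#) x n (derivative B)
      ≈⟨ derivative-sum lam x n B (normalised-vanishes α β γ n) ⟩
    (x + 1#) * risingSum (lam + 1#) x n B - risingSum lam x n B
      ≈⟨ sym (+-cong (*-congˡ (A≈risingSum S isS (lam + 1#) x n α β γ)) (-‿cong (A≈risingSum S isS lam x n α β γ))) ⟩
    (x + 1#) * A S (lam + 1#) x n α β γ - A S lam x n α β γ ∎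
    where
    B : ℕ → Carrier
    B = normalised α β γ n

  recurrence-α : ∀ S → IsGenStirling S → ∀ α β γ x lam n →
    A S lam x (suc n) α β (γ - α) - (x + 1#) * lam * β * A S (lam + 1#) x n α β γ
      ≈ (γ - α - lam * β) * A S lam x n α β γ
  recurrence-α S isS α β γ x lam n = begin
    A S lam x (suc n) α β (γ - α) - Q * A S (lam + 1#) x n α β γ
      ≈⟨ +-cong (trans (A≈risingSum S isS lam x (suc n) α β (γ - α))
                       (risingSum-cong lam x (suc n) (normalised-shift-α α β γ n)))
                (-‿cong (*-congˡ (A≈risingSum S isS (lam + 1#) x n α β γ))) ⟩
    risingSum lam x (suc n) (normStep β (γ - α) B) - Q * risingSum (lam + 1#) x n B
      ≈⟨ +-congʳ (normStep-sum lam x β (γ - α) n B (normalised-vanishes α β γ n)) ⟩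
    (Q * risingSum (lam + 1#) x n B + K * risingSum lam x n B) - Q * risingSum (lam + 1#) x n B
      ≈⟨ solve 3 (λ Q M N → (Q :* M :+ N) :- Q :* M := N) refl Q _ (K * risingSum lam x n B) ⟩
    K * risingSum lam x n B
      ≈⟨ *-congˡ (sym (A≈risingSum S isS lam x n α β γ)) ⟩
    K * A S lam x n α β γ ∎
    where
    B : ℕ → Carrier
    B = normalised α β γ n
    Q K : Carrier
    Q = (x + 1#) * lam * β
    K = γ - α - lam * β

mainTheorem5 : ∀ {c ℓ} (R : CommutativeRing c ℓ) →
    let open CommutativeRing R
        open GenStirling R
    in (S : ℕ → ℕ → Carrier → Carrier → Carrier → Carrier) →
       IsGenStirling S →
       ∀ (α β γ x lam : Carrier) (n : ℕ) →
         (x * A S (lam + 1#) x n α β (γ + β)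
           ≈ (x + 1#) * A S (lam + 1#) x n α β γ - A S lam x n α β γ)
         × (A S lam x (suc n) α β (γ - α) - (x + 1#) * lam * β * A S (lam + 1#) x n α β γ
           ≈ (γ - α - lam * β) * A S lam x n α β γ)
mainTheorem5 R S isS α β γ x lam n =
  recurrence-β S isS α β γ x lam n , recurrence-α S isS α β γ x lam n
  where open StirlingEulerian R
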